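{- Let $(S,t)$ be a finite-branching labelled transition system over $A\cup\{\tau\}$ with $A$ finite, modelled with divergence as in the context. For all $X,Y\in\mathcal{P}_\omega(S)$: $o^\sharp(X)=o^\sharp(Y)$ iff $o_2^\sharp(X)=o_2^\sharp(Y)$.
   Context: $x\xRightarrow{a}y$ iff $x\xrightarrow{\tau}^*\xrightarrow{a}\xrightarrow{\tau}^*y$; $x\not\downarrow$ iff $x$ has an infinite $\tau$-path; $x\downarrow a$ iff $x$ does not diverge and no $y$ with $x\xRightarrow{a}y$ diverges. $1=\{\top\}$. $t(x)(a)=\top$ if not $x\downarrow a$, else $\{y\mid x\xRightarrow{a}y\}$; $I(t(x))=\{a\mid t(x)(a)\neq\emptyset\}$; $Fail(t(x))=\{Z\subseteq A\mid Z\cap I(t(x))=\emptyset\}$. $o(x)=\top$ if $x\not\downarrow$; $o(x)=\bigcup_{x\xrightarrow{\tau}x'}o(x')$ if $x$ converges and $x\xrightarrow{\tau}$; otherwise $o(x)=Fail(t(x))$. On $1+\mathcal{P}(U)$ the join $\sqcup$ is union on subsets and $\top$ if an argument is $\top$; $o^\sharp(X)=\bigsqcup_{x\in X}o(x)$. For $I\subseteq\mathcal{P}(A)$, $min(I)$ is its set of $\subseteq$-minimal elements. $o_2(x)=\top$ if $x\not\downarrow$; $o_2(x)=min(\bigcup_{x\xrightarrow{\tau}x'}o_2(x'))$ if $x$ converges and $x\xrightarrow{\tau}$; otherwise $o_2(x)=\{I(t(x))\}$. $o_2^\sharp$ on $1+\mathcal{P}_\omega(S)$: $o_2^\sharp(\{x\})=o_2(x)$,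 $o_2^\sharp(\top)=\top$, $o_2^\sharp(\emptyset)=\emptyset$, $o_2^\sharp(X_1\cup X_2)=min(o_2^\sharp(X_1)\sqcup o_2^\sharp(X_2))$ (with $min(\top)=\top$). -}

module Defs where

open import Data.Nat using (ℕ; suc)
open import Data.Fin using (Fin)
open import Data.Fin.Subset using (Subset; _∈_; _⊆_)
open import Data.Maybe using (Maybe; just; nothing)
open import Data.List using (List; []; _∷_; mapMaybe)
open import Data.List.Membership.Propositional using () renaming (_∈_ to _∈ₗ_)
open import Data.Product using (Σ; ∃; ∃-syntax; _×_; _,_)
open import Data.Sum using (_⊎_)
open import Data.Empty using (⊥)
open import Data.Unit using (⊤)
open import Relation.Nullary using (¬_)
open import Relation.Binary.PropositionalEquality using (_≡_)

-- Values in 1 + P(U): ⊤ or a (propositional) subset of U.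

data Val (U : Set) : Set₁ where
  top : Val U
  set : (U → Set) → Val U

module _ {U : Set} where

  _⊔_ : Val U → Val U → Val U
  top   ⊔ _     = top
  set _ ⊔ top   = top
  set P ⊔ set Q = set (λ Z → P Z ⊎ Q Z)

  emptyV : Val U
  emptyV = set (λ _ → ⊥)

  _≈V_ : Val U → Val U → Set
  top   ≈V top   = ⊤
  top   ≈V set _ = ⊥
  set _ ≈V top   = ⊥
  set P ≈V set Q = ∀ Z → (P Z → Q Z) × (Q Z → P Z)

minV : ∀ {n} → Val (Subset n) → Val (Subset n)
minV top     = top
minV (set P) = set (λ Z → P Z × (∀ Z′ → P Z′ → Z′ ⊆ Z → Z′ ≡ Z))

-- Finite-branching LTS over A ∪ {τ}, A = Fin n (finite).
-- Labels: nothing = τ, just a = a ∈ A. Finite branching: the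
-- outgoing transitions of each state are given by a finite list.

record LTS (n : ℕ) : Set₁ where
  field
    State : Set
    succ  : State → List (Maybe (Fin n) × State)

module _ {n : ℕ} (L : LTS n) where
  open LTS L

  Step : State → Maybe (Fin n) → State → Set
  Step x α y = (α , y) ∈ₗ succ x

  data TauStar : State → State → Set where
    τ-refl : ∀ {x} → TauStar x x
    τ-step : ∀ {x y z} → Step x nothing y → TauStar y z → TauStar x z

  WeakStep : State → Fin n → State → Set
  WeakStep x a y = ∃[ x₁ ] ∃[ x₂ ] (TauStar x x₁ × Step x₁ (just a) x₂ × TauStar x₂ y)

  Diverges : State → Set
  Diverges x = Σ (ℕ → State) λ f → (f 0 ≡ x) × (∀ k → Step (f k) nothing (f (suc k)))

  Converges : State → Set
  Converges x = ¬ Diverges x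

  ConvA : State → Fin n → Set
  ConvA x a = Converges x × (∀ y → WeakStep x a y → Converges y)

  -- a ∈ I(t(x))  iff  t(x)(a) ≠ ∅, where t(x)(a) = ⊤ if not x↓a,
  -- and t(x)(a) = {y | x ⇒a y} otherwise.
  InI : State → Fin n → Set
  InI x a = (¬ ConvA x a) ⊎ (ConvA x a × ∃[ y ] WeakStep x a y)

  FailV : State → Val (Subset n)
  FailV x = set (λ Z → ∀ a → a ∈ Z → ¬ InI x a)

  SingI : State → Val (Subset n)
  SingI x = set (λ Z → ∀ a → (a ∈ Z → InI x a) × (InI x a → a ∈ Z))

  tauSuccs : State → List State
  tauSuccs x = mapMaybe sel (succ x)
    where
    sel : Maybe (Fin n) × State → Maybe State
    sel (nothing , y) = just y
    sel (just _  , _) = nothing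

  HasTau : State → Set
  HasTau x = ∃[ x′ ] Step x nothing x′

  -- Graph of o : S → 1 + P(P(A)), and of the join over a finite list.
  mutual
    data O : State → Val (Subset n) → Set₁ where
      o-div    : ∀ {x} → Diverges x → O x top
      o-tau    : ∀ {x v} → Converges x → HasTau x → OList (tauSuccs x) v → O x v
      o-stable : ∀ {x} → Converges x → ¬ HasTau x → O x (FailV x)

    data OList : List State → Val (Subset n) → Set₁ where
      ol-nil  : OList [] emptyV
      ol-cons : ∀ {y ys v w} → O y v → OList ys w → OList (y ∷ ys) (v ⊔ w)

  mutual
    data O₂ : State → Val (Subset n) → Set₁ where
      o₂-div    : ∀ {x} → Diverges x → O₂ x top
      o₂-tau    : ∀ {x v} → Converges x → HasTau x → O₂List (tauSuccs x) v → O₂ x (minV v)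
      o₂-stable : ∀ {x} → Converges x → ¬ HasTau x → O₂ x (SingI x)

    -- ⋃_{y ∈ ys} o₂(y)  (plain join, min applied by the caller)
    data O₂List : List State → Val (Subset n) → Set₁ where
      o₂l-nil  : O₂List [] emptyV
      o₂l-cons : ∀ {y ys v w} → O₂ y v → O₂List ys w → O₂List (y ∷ ys) (v ⊔ w)

  -- Graph of o♯ on finite sets X ∈ P_ω(S) (represented by lists)
  OSharp : List State → Val (Subset n) → Set₁
  OSharp = OList

  data O₂Sharp : List State → Val (Subset n) → Set₁ where
    o₂s-nil  : O₂Sharp [] emptyV
    o₂s-one  : ∀ {x v} → O₂ x v → O₂Sharp (x ∷ []) v
    o₂s-cons : ∀ {x y ys v w} → O₂ x v → O₂Sharp (y ∷ ys) w →
               O₂Sharp (x ∷ y ∷ ys) (minV (v ⊔ w))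

module Submission where

-- Both semantics are governed by a finite family Is of initial sets.  The
-- value of o is the set of refusals of Is (sets Z ⊆ A disjoint from some
-- I ∈ Is), while o₂ computes a family P of initial sets that *generates* Is:
-- every member of P lies in Is and every I ∈ Is lies above a member of P.
-- Taking ⊆-minimal elements preserves generation and yields an antichain.

open import Defs
open import Data.Nat using (ℕ)
open import Data.Nat.Induction using (<-wellFounded)
open import Induction.WellFounded using (WellFounded; Acc; acc; module Subrelation)
open import Relation.Binary.Construct.On as On using ()
open import Data.List using (List; []; _∷_; _++_; [_])
open import Data.List.Membership.Propositional using () renaming (_∈_ to _∈ₗ_)
open import Data.List.Membership.Propositional.Properties using (∈-++⁺ˡ; ∈-++⁺ʳ; ∈-++⁻)
open import Data.List.Relation.Unary.Any using (here)
open import Data.Fin using (Fin)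
open import Data.Fin.Subset using (Subset; _∈_; _⊆_; _⊂_; _⊄_; ∁; ∣_∣)
open import Data.Fin.Subset.Properties
  using (⊆-refl; ⊆-antisym; ⊆-trans; p⊂q⇒∣p∣<∣q∣; x∈∁p⇒x∉p; x∉p⇒x∈∁p; _∈?_)
open import Data.Vec using (tabulate)
open import Data.Vec.Properties using (lookup∘tabulate; []=⇒lookup; lookup⇒[]=)
open import Data.Bool using (true)
open import Data.Product using (∃-syntax; _×_; _,_; proj₁; proj₂; swap)
open import Data.Sum using (_⊎_; inj₁; inj₂; [_,_]′)
open import Data.Empty using (⊥; ⊥-elim)
open import Data.Unit using (⊤; tt)
open import Relation.Nullary using (¬_; Dec; yes; no; does)
open import Relation.Nullary.Decidable using (dec-true)
open import Relation.Binary.PropositionalEquality using (_≡_; refl; sym; trans; subst)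
open import Axiom.ExcludedMiddle using (ExcludedMiddle)
open import Level using (0ℓ)

≈V-sym : ∀ {U} {v w : Val U} → v ≈V w → w ≈V v
≈V-sym {v = top}   {top}   _ = tt
≈V-sym {v = set _} {set _} e Z = swap (e Z)

≈V-trans : ∀ {U} {u v w : Val U} → u ≈V v → v ≈V w → u ≈V w
≈V-trans {u = top}   {top}   {top}   _ _ = tt
≈V-trans {u = set _} {set _} {set _} e f Z =
  (λ p → proj₁ (f Z) (proj₁ (e Z) p)) , (λ r → proj₂ (e Z) (proj₂ (f Z) r))

⊔-cong : ∀ {U} {v v′ w w′ : Val U} → v ≈V v′ → w ≈V w′ → (v ⊔ w) ≈V (v′ ⊔ w′)
⊔-cong {v = top}   {top}                   _ _ = tt
⊔-cong {v = set _} {set _} {top}   {top}   _ _ = tt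
⊔-cong {v = set _} {set _} {set _} {set _} e f Z =
  [ (λ p → inj₁ (proj₁ (e Z) p)) , (λ q → inj₂ (proj₁ (f Z) q)) ]′ ,
  [ (λ p → inj₁ (proj₂ (e Z) p)) , (λ q → inj₂ (proj₂ (f Z) q)) ]′

⊔-emptyV : ∀ {U} (v : Val U) → (v ⊔ emptyV) ≈V v
⊔-emptyV top     = tt
⊔-emptyV (set _) Z = [ (λ p → p) , (λ ()) ]′ , inj₁

module SubsetOrder {n : ℕ} where

  ⊆∧⊄⇒≡ : {p q : Subset n} → p ⊆ q → p ⊄ q → p ≡ q
  ⊆∧⊄⇒≡ {p} {q} p⊆q p⊄q = ⊆-antisym p⊆q q⊆p
    where
    q⊆p : q ⊆ p
    q⊆p {x} x∈q with x ∈? p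
    ... | yes x∈p = x∈p
    ... | no  x∉p = ⊥-elim (p⊄q (p⊆q , x , x∈q , x∉p))

  ⊂-wellFounded : WellFounded (_⊂_ {n})
  ⊂-wellFounded = Subrelation.wellFounded p⊂q⇒∣p∣<∣q∣ (On.wellFounded ∣_∣ <-wellFounded)

  -- Disjointness: a set Z is refused by a stable state iff it is disjoint
  -- from the state's initial set.
  Disjoint : Subset n → Subset n → Set
  Disjoint Z I = ∀ a → a ∈ Z → a ∈ I → ⊥

  -- ∁ I is disjoint from I, and every set disjoint from ∁ I lies inside I;
  -- so ∁ I detects, through refusals, the sets contained in I.
  ∁-disjoint : ∀ I → Disjoint (∁ I) I
  ∁-disjoint I a a∈∁I a∈I = x∈∁p⇒x∉p a∈∁I a∈I

  disjoint-∁⇒⊆ : ∀ {I J} → Disjoint (∁ I) J → J ⊆ I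
  disjoint-∁⇒⊆ {I} d {a} a∈J with a ∈? I
  ... | yes a∈I = a∈I
  ... | no  a∉I = ⊥-elim (d a (x∉p⇒x∈∁p a∉I) a∈J)

  Family : Set₁
  Family = Subset n → Set

  _⊑_ : Family → Family → Set
  P ⊑ Q = ∀ Z → P Z → Q Z

  Refusals : List (Subset n) → Family
  Refusals Is Z = ∃[ I ] I ∈ₗ Is × Disjoint Z I

  refusals-++ : ∀ Is Js →
    set (λ Z → Refusals Is Z ⊎ Refusals Js Z) ≈V set (Refusals (Is ++ Js))
  refusals-++ Is Js Z =
    [ (λ { (I , I∈ , d) → I , ∈-++⁺ˡ I∈ , d }) , (λ { (J , J∈ , d) → J , ∈-++⁺ʳ Is J∈ , d }) ]′ ,
    (λ { (I , I∈ , d) → [ (λ I∈Is → inj₁ (I , I∈Is , d)) , (λ I∈Js → inj₂ (I , I∈Js , d)) ]′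
                          (∈-++⁻ Is I∈) })

  -- P generates the list Is: P is contained in Is and every member of Is
  -- lies above some member of P.  Generating families have the same
  -- minimal elements, and hence the same refusals, as Is.
  record Generates (P : Family) (Is : List (Subset n)) : Set where
    constructor generates
    field
      listed : ∀ Z → P Z → Z ∈ₗ Is
      below  : ∀ I → I ∈ₗ Is → ∃[ Z ] P Z × Z ⊆ I
  open Generates

  generates-++ : ∀ {P Q Is Js} → Generates P Is → Generates Q Js →
                 Generates (λ Z → P Z ⊎ Q Z) (Is ++ Js)
  generates-++ {P} {Q} {Is} {Js} g h = generates listed-++ below-++
    where
    listed-++ : ∀ Z → P Z ⊎ Q Z → Z ∈ₗ Is ++ Js
    listed-++ Z (inj₁ p) = ∈-++⁺ˡ (listed g Z p)
    listed-++ Z (inj₂ q) = ∈-++⁺ʳ Is (listed h Z q)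
    below-++ : ∀ I → I ∈ₗ Is ++ Js → ∃[ Z ] (P Z ⊎ Q Z) × Z ⊆ I
    below-++ I I∈ with ∈-++⁻ Is I∈
    ... | inj₁ I∈Is = let (Z , p , Z⊆I) = below g I I∈Is in Z , inj₁ p , Z⊆I
    ... | inj₂ I∈Js = let (Z , q , Z⊆I) = below h I I∈Js in Z , inj₂ q , Z⊆I

  Antichain : Family → Set
  Antichain P = ∀ {Z Z′} → P Z → P Z′ → Z′ ⊆ Z → Z′ ≡ Z

  Minimal : Family → Family
  Minimal P Z = P Z × (∀ Z′ → P Z′ → Z′ ⊆ Z → Z′ ≡ Z)

  minimal-antichain : ∀ P → Antichain (Minimal P)
  minimal-antichain P mZ mZ′ Z′⊆Z = proj₂ mZ _ (proj₁ mZ′) Z′⊆Z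

  -- Every member of a family lies above a minimal member (A is finite).
  minimal-below : ExcludedMiddle 0ℓ → ∀ P {Z} → P Z → ∃[ M ] Minimal P M × M ⊆ Z
  minimal-below em P {Z} pZ = go pZ (⊂-wellFounded Z)
    where
    go : ∀ {Z} → P Z → Acc _⊂_ Z → ∃[ M ] Minimal P M × M ⊆ Z
    go {Z} pZ (acc rec) with em {∃[ Z′ ] P Z′ × Z′ ⊂ Z}
    ... | yes (Z′ , pZ′ , Z′⊂Z) =
      let (M , minM , M⊆Z′) = go pZ′ (rec Z′⊂Z) in M , minM , ⊆-trans M⊆Z′ (proj₁ Z′⊂Z)
    ... | no none = Z , (pZ , minimal) , ⊆-refl
      where
      minimal : ∀ Z′ → P Z′ → Z′ ⊆ Z → Z′ ≡ Z
      minimal Z′ pZ′ Z′⊆Z = ⊆∧⊄⇒≡ Z′⊆Z (λ Z′⊂Z → none (Z′ , pZ′ , Z′⊂Z))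

  minimal-generates : ExcludedMiddle 0ℓ → ∀ {P Is} → Generates P Is → Generates (Minimal P) Is
  minimal-generates em {P} g = generates
    (λ Z mZ → listed g Z (proj₁ mZ))
    (λ I I∈ → let (Z , pZ , Z⊆I) = below g I I∈
                  (M , minM , M⊆Z) = minimal-below em P pZ
              in M , minM , ⊆-trans M⊆Z Z⊆I)

  -- If the refusals of Is are refusals of Js, then every member of a
  -- family generating Is lies above a member of a family generating Js:
  -- the complement of I is refused via I, hence via some J ⊆ I.
  dominated : ∀ {P Q Is Js} → Generates P Is → Generates Q Js →
              Refusals Is ⊑ Refusals Js → ∀ {I} → P I → ∃[ J ] Q J × J ⊆ I
  dominated g h sub {I} pI =
    let (J₀ , J₀∈ , d) = sub (∁ I) (I , listed g I pI , ∁-disjoint I)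
        (J , qJ , J⊆J₀) = below h J₀ J₀∈
    in J , qJ , ⊆-trans J⊆J₀ (disjoint-∁⇒⊆ d)

  antichain-⊑ : ∀ {P Q Is Js} → Generates P Is → Antichain P → Generates Q Js →
                Refusals Is ⊑ Refusals Js → Refusals Js ⊑ Refusals Is → P ⊑ Q
  antichain-⊑ {Q = Q} g anti h fwd bwd I pI =
    let (J , qJ , J⊆I) = dominated g h fwd pI
        (K , pK , K⊆J) = dominated h g bwd qJ
        K≡I = anti pI pK (⊆-trans K⊆J J⊆I)
    in subst Q (⊆-antisym J⊆I (subst (_⊆ J) K≡I K⊆J)) qJ

  refusals-mono : ∀ {P Q Is Js} → Generates P Is → Generates Q Js → P ⊑ Q →
                  Refusals Is ⊑ Refusals Js
  refusals-mono g h P⊑Q Z (I , I∈ , d) =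
    let (Z₀ , pZ₀ , Z₀⊆I) = below g I I∈
    in Z₀ , listed h Z₀ (P⊑Q Z₀ pZ₀) , (λ a a∈Z a∈Z₀ → d a a∈Z (Z₀⊆I a∈Z₀))

  refusals≈⇔antichains≈ : ∀ {P Q Is Js} → Generates P Is → Antichain P →
    Generates Q Js → Antichain Q →
    (set (Refusals Is) ≈V set (Refusals Js) → set P ≈V set Q) ×
    (set P ≈V set Q → set (Refusals Is) ≈V set (Refusals Js))
  refusals≈⇔antichains≈ g antiP h antiQ =
    (λ E I → antichain-⊑ g antiP h (λ Z → proj₁ (E Z)) (λ Z → proj₂ (E Z)) I ,
             antichain-⊑ h antiQ g (λ Z → proj₂ (E Z)) (λ Z → proj₁ (E Z)) I) ,
    (λ E Z → refusals-mono g h (λ Z → proj₁ (E Z)) Z , refusals-mono h g (λ Z → proj₂ (E Z)) Z)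

  Exactly : (Fin n → Set) → Family
  Exactly Q Z = ∀ a → (a ∈ Z → Q a) × (Q a → a ∈ Z)

  exactly-unique : ∀ {Q Z Z′} → Exactly Q Z → Exactly Q Z′ → Z ≡ Z′
  exactly-unique e e′ =
    ⊆-antisym (λ {a} a∈Z → proj₂ (e′ a) (proj₁ (e a) a∈Z))
              (λ {a} a∈Z′ → proj₂ (e a) (proj₁ (e′ a) a∈Z′))

  comprehension : ExcludedMiddle 0ℓ → ∀ Q → ∃[ I ] Exactly Q I
  comprehension em Q = I , λ a → sound a , complete a
    where
    decide : ∀ a → Dec (Q a)
    decide a = em {Q a}
    I = tabulate (λ a → does (decide a))
    witness : ∀ {A : Set} (d : Dec A) → does d ≡ true → A
    witness (yes p) _ = p
    sound : ∀ a → a ∈ I → Q a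
    sound a a∈I = witness (decide a) (trans (sym (lookup∘tabulate _ a)) ([]=⇒lookup a∈I))
    complete : ∀ a → Q a → a ∈ I
    complete a qa = lookup⇒[]= a I (trans (lookup∘tabulate _ a) (dec-true (decide a) qa))

  exactly-generates : ∀ {Q I} → Exactly Q I → Generates (Exactly Q) [ I ]
  exactly-generates eI = generates
    (λ Z eZ → here (exactly-unique eZ eI))
    (λ { I (here refl) → I , eI , ⊆-refl })

  avoiding≈refusals : ∀ {Q I} → Exactly Q I →
    set (λ Z → ∀ a → a ∈ Z → ¬ Q a) ≈V set (Refusals [ I ])
  avoiding≈refusals {I = I} eI Z =
    (λ avoid → I , here refl , (λ a a∈Z a∈I → avoid a a∈Z (proj₁ (eI a) a∈I))) ,
    (λ { (_ , here refl , d) a a∈Z qa → d a a∈Z (proj₂ (eI a) qa) })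

  -- Corr v u: either v and u are both ⊤, or v is (up to ≈V) the set of
  -- refusals of a list Is that u generates.  This is the invariant linking
  -- o and o₂.
  data Corr : Val (Subset n) → Val (Subset n) → Set₁ where
    both-top : Corr top top
    refuses  : ∀ {R P} Is → set R ≈V set (Refusals Is) → Generates P Is → Corr (set R) (set P)

  corr-empty : Corr emptyV emptyV
  corr-empty = refuses [] (λ Z → (λ ()) , (λ { (_ , () , _) })) (generates (λ _ ()) (λ _ ()))

  corr-⊔ : ∀ {v₁ u₁ v₂ u₂} → Corr v₁ u₁ → Corr v₂ u₂ → Corr (v₁ ⊔ v₂) (u₁ ⊔ u₂)
  corr-⊔ both-top           _                  = both-top
  corr-⊔ (refuses _ _ _)    both-top           = both-top
  corr-⊔ (refuses Is e₁ g₁) (refuses Js e₂ g₂) =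
    refuses (Is ++ Js) (≈V-trans (⊔-cong e₁ e₂) (refusals-++ Is Js)) (generates-++ g₁ g₂)

  corr-min : ExcludedMiddle 0ℓ → ∀ {v u} → Corr v u → Corr v (minV u)
  corr-min em both-top         = both-top
  corr-min em (refuses Is e g) = refuses Is e (minimal-generates em g)

  corr-resp : ∀ {v v′ u} → v ≈V v′ → Corr v u → Corr v′ u
  corr-resp {v′ = top}   _ both-top          = both-top
  corr-resp {v′ = set _} e (refuses Is e′ g) = refuses Is (≈V-trans (≈V-sym e) e′) g

  AntichainV : Val (Subset n) → Set
  AntichainV top     = ⊤
  AntichainV (set P) = Antichain P

  minV-antichain : ∀ u → AntichainV (minV u)
  minV-antichain top     = tt
  minV-antichain (set P) = minimal-antichain P

  corr-agree : ∀ {vX vY uX uY} → Corr vX uX → AntichainV uX → Corr vY uY → AntichainV uY →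
    (vX ≈V vY → uX ≈V uY) × (uX ≈V uY → vX ≈V vY)
  corr-agree both-top        _ both-top        _ = (λ _ → tt) , (λ _ → tt)
  corr-agree both-top        _ (refuses _ _ _) _ = (λ ()) , (λ ())
  corr-agree (refuses _ _ _) _ both-top        _ = (λ ()) , (λ ())
  corr-agree (refuses Is eX g) antiX (refuses Js eY h) antiY =
    (λ E → proj₁ key (≈V-trans (≈V-sym eX) (≈V-trans E eY))) ,
    (λ E → ≈V-trans eX (≈V-trans (proj₂ key E) (≈V-sym eY)))
    where key = refusals≈⇔antichains≈ g antiX h antiY

module Semantics (em : ExcludedMiddle 0ℓ) {n : ℕ} (L : LTS n) where
  open LTS L
  open SubsetOrder {n}

  stable-corr : ∀ x → Corr (FailV L x) (SingI L x)
  stable-corr x =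
    let (I , eI) = comprehension em (InI L x)
    in refuses [ I ] (avoiding≈refusals eI) (exactly-generates eI)

  -- o and o₂ are defined by the same case split on x, so their graphs
  -- agree on the case; mismatched cases contradict (non)divergence or
  -- (non)stability.
  mutual
    state-corr : ∀ {x v u} → O L x v → O₂ L x u → Corr v u
    state-corr (o-div _)       (o₂-div _)         = both-top
    state-corr (o-div d)       (o₂-tau c _ _)     = ⊥-elim (c d)
    state-corr (o-div d)       (o₂-stable c _)    = ⊥-elim (c d)
    state-corr (o-tau c _ _)   (o₂-div d)         = ⊥-elim (c d)
    state-corr (o-tau _ _ os)  (o₂-tau _ _ os₂)   = corr-min em (list-corr os os₂)
    state-corr (o-tau _ h _)   (o₂-stable _ ¬h)   = ⊥-elim (¬h h)
    state-corr (o-stable c _)  (o₂-div d)         = ⊥-elim (c d)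
    state-corr (o-stable _ ¬h) (o₂-tau _ h _)     = ⊥-elim (¬h h)
    state-corr {x} (o-stable _ _) (o₂-stable _ _) = stable-corr x

    list-corr : ∀ {ys v u} → OList L ys v → O₂List L ys u → Corr v u
    list-corr ol-nil           o₂l-nil            = corr-empty
    list-corr (ol-cons o os)   (o₂l-cons o₂ os₂)  = corr-⊔ (state-corr o o₂) (list-corr os os₂)

  -- o♯ joins the o-values while o₂♯ additionally minimises; Corr is
  -- insensitive to minimisation, so the two still correspond.
  sharp-corr : ∀ {X v u} → OSharp L X v → O₂Sharp L X u → Corr v u
  sharp-corr ol-nil                     o₂s-nil         = corr-empty
  sharp-corr (ol-cons {v = v} o ol-nil) (o₂s-one o₂)    =
    corr-resp (≈V-sym (⊔-emptyV v)) (state-corr o o₂)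
  sharp-corr (ol-cons o os)             (o₂s-cons o₂ s) =
    corr-min em (corr-⊔ (state-corr o o₂) (sharp-corr os s))

  -- Values of o₂ and o₂♯ are antichains: each is a singleton, ⊤ or a min.
  state-antichain : ∀ {x u} → O₂ L x u → AntichainV u
  state-antichain (o₂-div _)             = tt
  state-antichain (o₂-tau {v = v} _ _ _) = minV-antichain v
  state-antichain (o₂-stable _ _)        = λ eZ eZ′ _ → exactly-unique eZ′ eZ

  sharp-antichain : ∀ {X u} → O₂Sharp L X u → AntichainV u
  sharp-antichain o₂s-nil                    = λ ()
  sharp-antichain (o₂s-one o₂)               = state-antichain o₂
  sharp-antichain (o₂s-cons {v = v} {w} _ _) = minV-antichain (v ⊔ w)

proposition4p2 : ExcludedMiddle 0ℓ → (n : ℕ) (L : LTS n) (X Y : List (LTS.State L))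
    (vX vY uX uY : Val (Subset n)) →
    OSharp L X vX → OSharp L Y vY → O₂Sharp L X uX → O₂Sharp L Y uY →
    ((vX ≈V vY → uX ≈V uY) × (uX ≈V uY → vX ≈V vY))
proposition4p2 em n L X Y vX vY uX uY oX oY o₂X o₂Y =
  SubsetOrder.corr-agree (sharp-corr oX o₂X) (sharp-antichain o₂X)
                         (sharp-corr oY o₂Y) (sharp-antichain o₂Y)
  where open Semantics em L
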